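{- Let $n = 2^m$ with $m \geq 2$ and $N = n/2$. Let $H$ be the subgroup (under symmetric difference $\Delta$) of the power set of $\{1,\dots,N-1\}$ generated by $\{\{j, 2^{i-1}+j\} : j = 1, \dots, 2^{i-1}-1,\ i = 2, \dots, m-1\}$. Then for all $A, B \in H$, all integers $j$ with $2 \le j \le n/4$, all $r \in \{1, \dots, N\}$ and all $s \in \{2j-1, 2j, \dots, N+2j-2\}$, $$\overline{\langle N-r+1\rangle} \,\Delta\, \theta(\langle r-1\rangle) \neq A \,\Delta\, \langle 2j-2\rangle \,\Delta\, \overline{\langle N-s+2j-1\rangle} \,\Delta\, \theta\big(\langle s-1\rangle \Delta \langle 2j-2\rangle \Delta B\big).$$
   Context: Vertices of $Q_n$ are subsets of $\{1,\dots,n\}$. With $N = n/2$: $\langle 0\rangle = \emptyset$; $\langle i\rangle = \{1, \dots, i\}$ for $1 \le i \le N$; $\langle N+i\rangle = \{i+1, \dots, N\}$ for $1 \le i \le N$. For $X \subseteq \{1,\dots,N\}$, $\overline{X} = \{1,\dots,N\} \setminus X$. $\theta(i) = i + N$ for $i \in \{1,\dots,N\}$ and $\theta(X) = \{\theta(x) : x \in X\}$, $\theta(\emptyset)=\emptyset$. $\Delta$ is symmetric difference. -}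

module Defs where

open import Data.Nat using (ℕ; zero; suc; _+_; _*_; _∸_; _^_; _≤_; _≤ᵇ_)
open import Data.Bool using (Bool; true; false; _∧_; _xor_; not; if_then_else_)
open import Relation.Binary.PropositionalEquality using (_≡_)

-- A (finite) set of positive integers, represented by its characteristic
-- function on ℕ.  All sets below are subsets of {1,…,n}.
NSet : Set
NSet = ℕ → Bool

_≐_ : NSet → NSet → Set
X ≐ Y = ∀ x → X x ≡ Y x

∅ : NSet
∅ _ = false

_Δ_ : NSet → NSet → NSet
(X Δ Y) x = X x xor Y x
infixl 6 _Δ_

[_⋯_] : ℕ → ℕ → NSet
[ a ⋯ b ] x = (a ≤ᵇ x) ∧ (x ≤ᵇ b)

-- ⟨ k ⟩ with parameter N (0 ≤ k ≤ 2N):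
--   ⟨0⟩ = ∅, ⟨i⟩ = {1,…,i} for 1 ≤ i ≤ N, ⟨N+i⟩ = {i+1,…,N} for 1 ≤ i ≤ N.
⟨_⟩[_] : ℕ → ℕ → NSet
⟨ k ⟩[ N ] = if k ≤ᵇ N then [ 1 ⋯ k ] else [ suc (k ∸ N) ⋯ N ]

co[_] : ℕ → NSet → NSet
co[ N ] X x = [ 1 ⋯ N ] x ∧ not (X x)

θ[_] : ℕ → NSet → NSet
θ[ N ] X x = (suc N ≤ᵇ x) ∧ X (x ∸ N)

pair : ℕ → ℕ → NSet
pair a b x = [ a ⋯ a ] x xor [ b ⋯ b ] x

data IsGen (m : ℕ) : NSet → Set where
  gen : ∀ i j → 2 ≤ i → i ≤ m ∸ 1 → 1 ≤ j → j ≤ 2 ^ (i ∸ 1) ∸ 1 →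
        IsGen m (pair j (2 ^ (i ∸ 1) + j))

-- H: the subgroup of (P({1,…,N-1}), Δ) generated by the generators.
-- (Every element of a group of exponent 2 generated by a set is a finite
-- Δ-sum of generators.)
data InH (m : ℕ) : NSet → Set where
  H-∅   : InH m ∅
  H-gen : ∀ {g X} → IsGen m g → InH m X → InH m (g Δ X)

-- For every t the map X ↦ parity of |X ∩ 2^t ℕ ∩ {1,…,N}| is Δ-linear and vanishes on every
-- generator {j, 2^e + j} (as j < 2^e, j and 2^e + j are equally divisible by 2^t), hence on H.
-- Evaluating it on the lower half {1,…,N} and on the upper half N + {1,…,N} of both sides turns the
-- set equation into congruences mod 2 between the quotients ⌊·/2^t⌋ of r − 1, s − 1, 2j − 2 and N.
-- If s − 1 ≥ N the level 2^t = N already fails.  Otherwise write 2j − 2 = 2^(K+1) · odd: level K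
-- forces r − 1 and s + 1 − 2j to be equally divisible by 2^(K+1), while level K + 1 forces the opposite.

module Submission where

open import Defs
open import Data.Nat using (ℕ; zero; suc; _+_; _*_; _∸_; _^_; _≤_; _<_; _≤ᵇ_; _≤?_; z≤n; s≤s; z<s)
open import Data.Nat.Properties
open import Data.Nat.Divisibility
  using (_∣_; _∣?_; divides; ∣-refl; ∣-trans; ∣⇒≤; _∣0; 1∣_; m∣m*n; n∣m*n; ∣m∣n⇒∣m+n; ∣m+n∣m⇒∣n;
         *-monoˡ-∣; *-cancelʳ-∣)
open import Data.Bool using (Bool; true; false; _∧_; _xor_; not)
open import Data.Bool.Properties
  using (not-injective; not-¬; ∧-zeroʳ; ∧-identityʳ; ∧-distribʳ-xor; xor-assoc; xor-comm; xor-identityʳ; xor-same)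
open import Data.Bool.Solver using (module xor-∧-Solver)
open import Data.Product using (∃; _×_; _,_; proj₁; proj₂)
open import Data.Sum using (inj₁; inj₂)
open import Data.Empty using (⊥)
open import Relation.Nullary using (¬_; Dec; does; yes; no; contradiction)
open import Relation.Nullary.Decidable using (dec-true; dec-false)
open import Relation.Binary.PropositionalEquality
open ≡-Reasoning
open xor-∧-Solver using (solve; _:=_; _:+_; con)

≤⇒≤ᵇ≡true : ∀ {m n} → m ≤ n → (m ≤ᵇ n) ≡ true
≤⇒≤ᵇ≡true {m} {n} = dec-true (m ≤? n)

>⇒≤ᵇ≡false : ∀ {m n} → n < m → (m ≤ᵇ n) ≡ false
>⇒≤ᵇ≡false {m} {n} n<m = dec-false (m ≤? n) (<⇒≱ n<m)

∈-⋯ : ∀ {a b x} → a ≤ x → x ≤ b → [ a ⋯ b ] x ≡ true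
∈-⋯ a≤x x≤b = cong₂ _∧_ (≤⇒≤ᵇ≡true a≤x) (≤⇒≤ᵇ≡true x≤b)

∉-⋯ˡ : ∀ {a b x} → x < a → [ a ⋯ b ] x ≡ false
∉-⋯ˡ {b = b} {x} x<a = cong (_∧ (x ≤ᵇ b)) (>⇒≤ᵇ≡false x<a)

∉-⋯ʳ : ∀ {a b x} → b < x → [ a ⋯ b ] x ≡ false
∉-⋯ʳ {a} {x = x} b<x = trans (cong ((a ≤ᵇ x) ∧_) (>⇒≤ᵇ≡false b<x)) (∧-zeroʳ _)

not-∧ : ∀ a b → not a ∧ b ≡ b xor (a ∧ b)
not-∧ true  b = sym (xor-same b)
not-∧ false b = sym (xor-identityʳ b)

xor-cancelˡ : ∀ a {b c} → a xor b ≡ a xor c → b ≡ c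
xor-cancelˡ false b≡c = b≡c
xor-cancelˡ true  b≡c = not-injective b≡c

oddCard : NSet → ℕ → Bool
oddCard X zero    = false
oddCard X (suc n) = oddCard X n xor X (suc n)

_∩_ : NSet → NSet → NSet
(X ∩ Y) x = X x ∧ Y x
infixl 7 _∩_

oddCard-cong : ∀ {X Y} n → (∀ x → 1 ≤ x → x ≤ n → X x ≡ Y x) → oddCard X n ≡ oddCard Y n
oddCard-cong zero    _   = refl
oddCard-cong (suc n) X≗Y =
  cong₂ _xor_ (oddCard-cong n λ x 1≤x x≤n → X≗Y x 1≤x (m≤n⇒m≤1+n x≤n)) (X≗Y (suc n) z<s ≤-refl)

oddCard-beyond : ∀ {X n} n′ → n ≤ n′ → (∀ x → n < x → x ≤ n′ → X x ≡ false) → oddCard X n′ ≡ oddCard X n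
oddCard-beyond zero z≤n _ = refl
oddCard-beyond (suc n′) n≤1+n′ X≗∅ with m≤n⇒m<n∨m≡n n≤1+n′
... | inj₂ refl = refl
... | inj₁ (s≤s n≤n′) = trans
  (cong₂ _xor_ (oddCard-beyond n′ n≤n′ λ x n<x x≤n′ → X≗∅ x n<x (m≤n⇒m≤1+n x≤n′)) (X≗∅ (suc n′) (s≤s n≤n′) ≤-refl))
  (xor-identityʳ _)

oddCard-vanishing : ∀ {X} n → (∀ x → 1 ≤ x → x ≤ n → X x ≡ false) → oddCard X n ≡ false
oddCard-vanishing n = oddCard-beyond n z≤n

oddCard-Δ : ∀ X Y n → oddCard (X Δ Y) n ≡ oddCard X n xor oddCard Y n
oddCard-Δ X Y zero    = refl
oddCard-Δ X Y (suc n) = begin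
  oddCard (X Δ Y) n xor (X (suc n) xor Y (suc n))
    ≡⟨ cong (_xor (X (suc n) xor Y (suc n))) (oddCard-Δ X Y n) ⟩
  (oddCard X n xor oddCard Y n) xor (X (suc n) xor Y (suc n))
    ≡⟨ solve 4 (λ p q x y → (p :+ q) :+ (x :+ y) := (p :+ x) :+ (q :+ y)) refl
         (oddCard X n) (oddCard Y n) (X (suc n)) (Y (suc n)) ⟩
  oddCard X (suc n) xor oddCard Y (suc n) ∎

oddCard-Δ-∩ : ∀ X Y D n → oddCard ((X Δ Y) ∩ D) n ≡ oddCard (X ∩ D) n xor oddCard (Y ∩ D) n
oddCard-Δ-∩ X Y D n =
  trans (oddCard-cong n λ x _ _ → ∧-distribʳ-xor (D x) (X x) (Y x)) (oddCard-Δ (X ∩ D) (Y ∩ D) n)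

oddCard-prefix : ∀ D {h n} → h ≤ n → oddCard ([ 1 ⋯ h ] ∩ D) n ≡ oddCard D h
oddCard-prefix D {h} {n} h≤n = begin
  oddCard ([ 1 ⋯ h ] ∩ D) n ≡⟨ oddCard-beyond n h≤n (λ x h<x _ → cong (_∧ D x) (∉-⋯ʳ h<x)) ⟩
  oddCard ([ 1 ⋯ h ] ∩ D) h ≡⟨ oddCard-cong h (λ x 1≤x x≤h → cong (_∧ D x) (∈-⋯ 1≤x x≤h)) ⟩
  oddCard D h               ∎

oddCard-singleton : ∀ D {z n} → 1 ≤ z → z ≤ n → oddCard ([ z ⋯ z ] ∩ D) n ≡ D z
oddCard-singleton D {suc z} {n} _ z<n = begin
  oddCard ([ suc z ⋯ suc z ] ∩ D) n
    ≡⟨ oddCard-beyond n z<n (λ x z<x _ → cong (_∧ D x) (∉-⋯ʳ z<x)) ⟩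
  oddCard ([ suc z ⋯ suc z ] ∩ D) z xor ([ suc z ⋯ suc z ] (suc z) ∧ D (suc z))
    ≡⟨ cong₂ _xor_ (oddCard-vanishing z λ x _ x≤z → cong (_∧ D x) (∉-⋯ˡ (s≤s x≤z)))
                   (cong (_∧ D (suc z)) (∈-⋯ {suc z} ≤-refl ≤-refl)) ⟩
  D (suc z) ∎

^-monoʳ-∣ : ∀ m {n o} → n ≤ o → m ^ n ∣ m ^ o
^-monoʳ-∣ m {n} n≤o with m≤n⇒∃[o]m+o≡n n≤o
... | d , refl = divides (m ^ d) (trans (^-distribˡ-+-* m n d) (*-comm (m ^ n) (m ^ d)))

2^+<2^suc : ∀ e {j} → j < 2 ^ e → 2 ^ e + j < 2 ^ suc e
2^+<2^suc e j<2^e =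
  <-≤-trans (+-monoʳ-< (2 ^ e) j<2^e) (≤-reflexive (cong (2 ^ e +_) (sym (+-identityʳ (2 ^ e)))))

does-cong : ∀ {A B : Set} (A? : Dec A) (B? : Dec B) → (A → B) → (B → A) → does A? ≡ does B?
does-cong (yes _) (yes _) _   _   = refl
does-cong (no _)  (no _)  _   _   = refl
does-cong (yes a) (no ¬b) a→b _   = contradiction (a→b a) ¬b
does-cong (no ¬a) (yes b) _   b→a = contradiction (b→a b) ¬a

multiples : ℕ → NSet
multiples t x = does (2 ^ t ∣? x)

-- oddQuot t n is the parity of ⌊n / 2^t⌋, the number of multiples of 2^t in {1,…,n}.
oddQuot : ℕ → ℕ → Bool
oddQuot t = oddCard (multiples t)

multiples-complete : ∀ t {x} → 2 ^ t ∣ x → multiples t x ≡ true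
multiples-complete t {x} = dec-true (2 ^ t ∣? x)

multiples-sound : ∀ t {x} → multiples t x ≡ true → 2 ^ t ∣ x
multiples-sound t {x} x∈ with 2 ^ t ∣? x
... | yes 2^t∣x = 2^t∣x
... | no  _     = contradiction x∈ λ ()

multiples-+ : ∀ t {c} x → 2 ^ t ∣ c → multiples t (c + x) ≡ multiples t x
multiples-+ t {c} x 2^t∣c =
  does-cong (2 ^ t ∣? (c + x)) (2 ^ t ∣? x) (λ d → ∣m+n∣m⇒∣n d 2^t∣c) (∣m∣n⇒∣m+n 2^t∣c)

multiples-sum : ∀ t x y → 2 ^ t ∣ x + y → multiples t x ≡ multiples t y
multiples-sum t x y 2^t∣x+y = does-cong (2 ^ t ∣? x) (2 ^ t ∣? y)
  (∣m+n∣m⇒∣n 2^t∣x+y) (∣m+n∣m⇒∣n (subst (2 ^ t ∣_) (+-comm x y) 2^t∣x+y))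

multiples-small : ∀ t {x} → 0 < x → x < 2 ^ t → multiples t x ≡ false
multiples-small t {suc x} _ x<2^t = dec-false (2 ^ t ∣? suc x) λ d → <⇒≱ x<2^t (∣⇒≤ d)

multiples-2^+ : ∀ t {e j} → 0 < j → j < 2 ^ e → multiples t (2 ^ e + j) ≡ multiples t j
multiples-2^+ t {e} {j} 0<j j<2^e with ≤-<-connex t e
... | inj₁ t≤e = multiples-+ t j (^-monoʳ-∣ 2 t≤e)
... | inj₂ e<t = trans
  (multiples-small t (<-≤-trans 0<j (m≤n+m j _)) (<-≤-trans (2^+<2^suc e j<2^e) (^-monoʳ-≤ 2 e<t)))
  (sym (multiples-small t 0<j (<-trans j<2^e (^-monoʳ-< 2 (s≤s (s≤s z≤n)) e<t))))

oddQuot-small : ∀ t {n} → n < 2 ^ t → oddQuot t n ≡ false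
oddQuot-small t {n} n<2^t = oddCard-vanishing n λ x 0<x x≤n → multiples-small t 0<x (≤-<-trans x≤n n<2^t)

oddCard-∩-multiples-pow : ∀ X t → oddCard (X ∩ multiples t) (2 ^ t) ≡ X (2 ^ t)
oddCard-∩-multiples-pow X t = begin
  oddCard (X ∩ multiples t) (2 ^ t)
    ≡⟨ cong (oddCard (X ∩ multiples t)) 1+p≡2^t ⟨
  oddCard (X ∩ multiples t) p xor (X (suc p) ∧ multiples t (suc p))
    ≡⟨ cong₂ _xor_ (oddCard-vanishing p λ x 0<x x≤p →
                      trans (cong (X x ∧_) (multiples-small t 0<x (subst (x <_) 1+p≡2^t (s≤s x≤p)))) (∧-zeroʳ _))
                   (cong (X (suc p) ∧_) (multiples-complete t (subst (2 ^ t ∣_) (sym 1+p≡2^t) ∣-refl))) ⟩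
  X (suc p) ∧ true
    ≡⟨ ∧-identityʳ _ ⟩
  X (suc p)
    ≡⟨ cong X 1+p≡2^t ⟩
  X (2 ^ t) ∎
  where
  p : ℕ
  p = 2 ^ t ∸ 1
  1+p≡2^t : suc p ≡ 2 ^ t
  1+p≡2^t = suc-pred (2 ^ t) {{m^n≢0 2 t}}

oddQuot-pow : ∀ t → oddQuot t (2 ^ t) ≡ true
oddQuot-pow = oddCard-∩-multiples-pow (λ _ → true)

oddQuot-+ : ∀ t {c} y → 2 ^ t ∣ c → oddQuot t (c + y) ≡ oddQuot t c xor oddQuot t y
oddQuot-+ t {c} zero    _     = trans (cong (oddQuot t) (+-identityʳ c)) (sym (xor-identityʳ _))
oddQuot-+ t {c} (suc y) 2^t∣c = begin
  oddQuot t (c + suc y)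
    ≡⟨ cong (oddQuot t) (+-suc c y) ⟩
  oddQuot t (c + y) xor multiples t (suc (c + y))
    ≡⟨ cong₂ _xor_ (oddQuot-+ t y 2^t∣c)
                   (trans (cong (multiples t) (sym (+-suc c y))) (multiples-+ t (suc y) 2^t∣c)) ⟩
  (oddQuot t c xor oddQuot t y) xor multiples t (suc y)
    ≡⟨ xor-assoc (oddQuot t c) _ _ ⟩
  oddQuot t c xor oddQuot t (suc y) ∎

oddQuot-scale : ∀ t α → oddQuot t (α * 2 ^ t) ≡ oddQuot 0 α
oddQuot-scale t zero    = refl
oddQuot-scale t (suc α) = begin
  oddQuot t (2 ^ t + α * 2 ^ t)                ≡⟨ oddQuot-+ t (α * 2 ^ t) ∣-refl ⟩
  oddQuot t (2 ^ t) xor oddQuot t (α * 2 ^ t)  ≡⟨ cong₂ _xor_ (oddQuot-pow t) (oddQuot-scale t α) ⟩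
  true xor oddQuot 0 α                         ≡⟨ xor-comm true _ ⟩
  oddQuot 0 α xor true                         ≡⟨ cong (oddQuot 0 α xor_) (multiples-complete 0 (1∣ suc α)) ⟨
  oddQuot 0 (suc α)                            ∎

multiples-scale : ∀ t α → multiples (suc t) (α * 2 ^ t) ≡ multiples 1 α
multiples-scale t α = does-cong (2 ^ suc t ∣? α * 2 ^ t) (2 ^ 1 ∣? α)
  (*-cancelʳ-∣ (2 ^ t) {{m^n≢0 2 t}}) (*-monoˡ-∣ (2 ^ t))

multiples-1 : ∀ x → multiples 1 x ≡ not (oddQuot 0 x)
multiples-1 zero          = refl
multiples-1 (suc zero)    = refl
multiples-1 (suc (suc x)) = begin
  multiples 1 (2 + x)  ≡⟨ multiples-+ 1 x ∣-refl ⟩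
  multiples 1 x        ≡⟨ multiples-1 x ⟩
  not (oddQuot 0 x)    ≡⟨ cong not (solve 1 (λ q → q := (q :+ con true) :+ con true) refl (oddQuot 0 x)) ⟩
  not ((oddQuot 0 x xor true) xor true)
    ≡⟨ cong₂ (λ b b′ → not ((oddQuot 0 x xor b) xor b′))
             (multiples-complete 0 (1∣ suc x)) (multiples-complete 0 (1∣ suc (suc x))) ⟨
  not (oddQuot 0 (2 + x)) ∎

multiples-suc : ∀ t x → multiples (suc t) x ≡ multiples t x ∧ not (oddQuot t x)
multiples-suc t x with multiples t x in x∈?
... | false = dec-false (2 ^ suc t ∣? x) λ 2^t+1∣x →
  contradiction (trans (sym x∈?) (multiples-complete t (∣-trans (n∣m*n 2) 2^t+1∣x))) λ ()
... | true  with multiples-sound t x∈?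
...   | divides α refl = begin
  multiples (suc t) (α * 2 ^ t)  ≡⟨ multiples-scale t α ⟩
  multiples 1 α                  ≡⟨ multiples-1 α ⟩
  not (oddQuot 0 α)              ≡⟨ cong not (oddQuot-scale t α) ⟨
  not (oddQuot t (α * 2 ^ t))    ∎

-- ⌊(n − a)/2^t⌋ = n/2^t − ⌈a/2^t⌉ for 2^t ∣ n, and ⌈a/2^t⌉ = ⌊a/2^t⌋ + [2^t ∤ a].
oddQuot-complement : ∀ t {n} → 2 ^ t ∣ n → ∀ w a → w + a ≡ n →
  oddQuot t w ≡ oddQuot t n xor (oddQuot t a xor not (multiples t a))
oddQuot-complement t {n} _ w zero w+0≡n = begin
  oddQuot t w              ≡⟨ cong (oddQuot t) (trans (sym (+-identityʳ w)) w+0≡n) ⟩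
  oddQuot t n              ≡⟨ xor-identityʳ _ ⟨
  oddQuot t n xor false    ≡⟨ cong (λ b → oddQuot t n xor not b) (multiples-complete t (_ ∣0)) ⟨
  oddQuot t n xor not (multiples t 0) ∎
oddQuot-complement t {n} 2^t∣n w (suc a) w+1+a≡n = begin
  oddQuot t w
    ≡⟨ solve 2 (λ q m → q := (q :+ m) :+ m) refl (oddQuot t w) (multiples t (suc w)) ⟩
  oddQuot t (suc w) xor multiples t (suc w)
    ≡⟨ cong₂ _xor_ (oddQuot-complement t 2^t∣n (suc w) a 1+w+a≡n)
                   (multiples-sum t (suc w) a (subst (2 ^ t ∣_) (sym 1+w+a≡n) 2^t∣n)) ⟩
  (oddQuot t n xor (oddQuot t a xor not (multiples t a))) xor multiples t a
    ≡⟨ solve 4 (λ n q m d → (n :+ (q :+ (con true :+ m))) :+ m := n :+ ((q :+ d) :+ (con true :+ d))) refl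
         (oddQuot t n) (oddQuot t a) (multiples t a) (multiples t (suc a)) ⟩
  oddQuot t n xor (oddQuot t (suc a) xor not (multiples t (suc a))) ∎
  where
  1+w+a≡n : suc w + a ≡ n
  1+w+a≡n = trans (sym (+-suc w a)) w+1+a≡n

oddQuot-below-valuation : ∀ t {c} → 2 ^ suc t ∣ c → oddQuot t c ≡ false
oddQuot-below-valuation t {c} 2^t+1∣c with oddQuot t c | multiples-suc t c
... | false | _ = refl
... | true  | c∈t+1 =
  contradiction (trans (sym (multiples-complete (suc t) 2^t+1∣c)) (trans c∈t+1 (∧-zeroʳ _))) λ ()

oddQuot-at-valuation : ∀ t {c} → multiples t c ≡ true → multiples (suc t) c ≡ false → oddQuot t c ≡ true
oddQuot-at-valuation t {c} c∈t c∉t+1 with oddQuot t c | multiples-suc t c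
... | true  | _ = refl
... | false | c∈t+1 = contradiction (trans (sym c∉t+1) (trans c∈t+1 (cong (_∧ true) c∈t))) λ ()

true-until-false : ∀ (f : ℕ → Bool) i d → f i ≡ true → f (i + d) ≡ false →
  ∃ λ t → i ≤ t × t < i + d × f t ≡ true × f (suc t) ≡ false
true-until-false f i zero    fi fi+0 =
  contradiction (trans (sym fi) (trans (cong f (sym (+-identityʳ i))) fi+0)) λ ()
true-until-false f i (suc d) fi fi+1+d with f (suc i) in f1+i
... | false = i , ≤-refl , m<m+n i z<s , fi , f1+i
... | true  with true-until-false f (suc i) d f1+i (trans (cong f (sym (+-suc i d))) fi+1+d)
...   | t , 1+i≤t , t<1+i+d , ft , f1+t =
  t , <⇒≤ 1+i≤t , subst (t <_) (sym (+-suc i d)) t<1+i+d , ft , f1+t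

exact-power-of-two : ∀ M {c} → 0 < c → 2 ∣ c → c < 2 ^ M →
  ∃ λ K → suc K < M × 2 ^ suc K ∣ c × oddQuot (suc K) c ≡ true
exact-power-of-two zero    0<c _   c<1 = contradiction 0<c (<⇒≱ c<1)
exact-power-of-two (suc M) {c} 0<c 2∣c c<N
  with true-until-false (λ t → multiples t c) 1 M (multiples-complete 1 2∣c) (multiples-small (suc M) 0<c c<N)
... | suc K , s≤s _ , K+1<1+M , c∈K+1 , c∉K+2 =
  K , K+1<1+M , multiples-sound (suc K) c∈K+1 , oddQuot-at-valuation (suc K) c∈K+1 c∉K+2

-- Modulo 2, the first hypothesis says ⌈a/2^t⌉ + ⌈y/2^t⌉ ≡ ⌊c/2^t⌋ and the second ⌊a/2^t⌋ ≡ ⌊y/2^t⌋.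
parity-balance : ∀ t {n a c y u k} → 2 ^ t ∣ n → 2 ^ t ∣ c → u + a ≡ n → k + y ≡ n →
  oddQuot t u ≡ oddQuot t c xor oddQuot t k →
  oddQuot t a ≡ oddQuot t (c + y) xor oddQuot t c →
  oddQuot t a ≡ oddQuot t y × multiples t a ≡ oddQuot t c xor multiples t y
parity-balance t {n} {a} {c} {y} {u} {k} 2^t∣n 2^t∣c u+a≡n k+y≡n low high = quot-eq , mult-eq
  where
  quot-eq : oddQuot t a ≡ oddQuot t y
  quot-eq = begin
    oddQuot t a                                    ≡⟨ high ⟩
    oddQuot t (c + y) xor oddQuot t c              ≡⟨ cong (_xor oddQuot t c) (oddQuot-+ t y 2^t∣c) ⟩
    (oddQuot t c xor oddQuot t y) xor oddQuot t c
      ≡⟨ solve 2 (λ q r → (q :+ r) :+ q := r) refl (oddQuot t c) (oddQuot t y) ⟩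
    oddQuot t y                                    ∎

  low′ : oddQuot t n xor (oddQuot t a xor not (multiples t a))
       ≡ oddQuot t c xor (oddQuot t n xor (oddQuot t y xor not (multiples t y)))
  low′ = trans (sym (oddQuot-complement t 2^t∣n u a u+a≡n))
               (trans low (cong (oddQuot t c xor_) (oddQuot-complement t 2^t∣n k y k+y≡n)))

  mult-eq : multiples t a ≡ oddQuot t c xor multiples t y
  mult-eq = begin
    multiples t a
      ≡⟨ solve 3 (λ n q m → m := (n :+ (q :+ (con true :+ m))) :+ ((n :+ q) :+ con true)) refl
           (oddQuot t n) (oddQuot t a) (multiples t a) ⟩
    (oddQuot t n xor (oddQuot t a xor not (multiples t a))) xor ((oddQuot t n xor oddQuot t a) xor true)
      ≡⟨ cong₂ _xor_ low′ (cong (λ q → (oddQuot t n xor q) xor true) quot-eq) ⟩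
    (oddQuot t c xor (oddQuot t n xor (oddQuot t y xor not (multiples t y))))
      xor ((oddQuot t n xor oddQuot t y) xor true)
      ≡⟨ solve 4 (λ p n q m → (p :+ (n :+ (q :+ (con true :+ m)))) :+ ((n :+ q) :+ con true) := p :+ m) refl
           (oddQuot t c) (oddQuot t n) (oddQuot t y) (multiples t y) ⟩
    oddQuot t c xor multiples t y ∎

parity-obstruction : ∀ M u a c k y → u + a ≡ 2 ^ M → k + y ≡ 2 ^ M → 0 < c → 2 ∣ c → c < 2 ^ M →
  (∀ t → oddQuot t u ≡ oddQuot t c xor oddQuot t k) →
  (∀ t → oddQuot t a ≡ oddQuot t (c + y) xor oddQuot t c) → ⊥
parity-obstruction M u a c k y u+a≡N k+y≡N 0<c 2∣c c<N low high
  with exact-power-of-two M 0<c 2∣c c<N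
... | K , K+1<M , 2^K+1∣c , odd-at-K+1 = not-¬ same-at-K+1 opposite-at-K+1
  where
  Balance : ℕ → Set
  Balance t = oddQuot t a ≡ oddQuot t y × multiples t a ≡ oddQuot t c xor multiples t y

  balance : ∀ t → t ≤ M → 2 ^ t ∣ c → Balance t
  balance t t≤M 2^t∣c = parity-balance t (^-monoʳ-∣ 2 t≤M) 2^t∣c u+a≡N k+y≡N (low t) (high t)

  at-K : Balance K
  at-K = balance K (≤-trans (n≤1+n K) (<⇒≤ K+1<M)) (∣-trans (n∣m*n 2) 2^K+1∣c)

  at-K+1 : Balance (suc K)
  at-K+1 = balance (suc K) (<⇒≤ K+1<M) 2^K+1∣c

  same-at-K+1 : multiples (suc K) a ≡ multiples (suc K) y
  same-at-K+1 = begin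
    multiples (suc K) a                 ≡⟨ multiples-suc K a ⟩
    multiples K a ∧ not (oddQuot K a)   ≡⟨ cong₂ (λ m q → m ∧ not q) mult-K (proj₁ at-K) ⟩
    multiples K y ∧ not (oddQuot K y)   ≡⟨ multiples-suc K y ⟨
    multiples (suc K) y                 ∎
    where
    mult-K : multiples K a ≡ multiples K y
    mult-K = trans (proj₂ at-K) (cong (_xor multiples K y) (oddQuot-below-valuation K 2^K+1∣c))

  opposite-at-K+1 : multiples (suc K) a ≡ not (multiples (suc K) y)
  opposite-at-K+1 = trans (proj₂ at-K+1) (cong (_xor multiples (suc K) y) odd-at-K+1)

shift : ℕ → NSet → NSet
shift N X y = X (N + y)

⟨⟩-lower : ∀ {N k} → k ≤ N → ∀ x → ⟨ k ⟩[ N ] x ≡ [ 1 ⋯ k ] x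
⟨⟩-lower k≤N x rewrite ≤⇒≤ᵇ≡true k≤N = refl

⟨⟩-∋-top : ∀ {N k} → N ≤ k → k < N + N → ⟨ k ⟩[ N ] N ≡ true
⟨⟩-∋-top {zero}  _   ()
⟨⟩-∋-top {suc N} {k} N≤k k<2N with k ≤ᵇ suc N
... | true  = ∈-⋯ (s≤s z≤n) N≤k
... | false = ∈-⋯ (<-≤-trans (∸-monoˡ-< k<2N N≤k) (≤-reflexive (m+n∸m≡n (suc N) (suc N)))) ≤-refl

-- The two sides of the equation, with u = N − r + 1, a = r − 1, c = 2j − 2, k = N + 2j − 1 − s, s′ = s − 1.
leftSide : ℕ → ℕ → ℕ → NSet
leftSide N u a = co[ N ] ⟨ u ⟩[ N ] Δ θ[ N ] ⟨ a ⟩[ N ]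

rightSide : ℕ → NSet → NSet → ℕ → ℕ → ℕ → NSet
rightSide N A B c k s′ = A Δ ⟨ c ⟩[ N ] Δ co[ N ] ⟨ k ⟩[ N ] Δ θ[ N ] (⟨ s′ ⟩[ N ] Δ ⟨ c ⟩[ N ] Δ B)

module Count (N : ℕ) (D : NSet) where

  #_ : NSet → Bool
  # X = oddCard (X ∩ D) N

  #↑_ : NSet → Bool
  #↑ X = # shift N X

  #-≐ : ∀ {X Y} → X ≐ Y → # X ≡ # Y
  #-≐ X≐Y = oddCard-cong N λ x _ _ → cong (_∧ D x) (X≐Y x)

  #↑-≐ : ∀ {X Y} → X ≐ Y → #↑ X ≡ #↑ Y
  #↑-≐ X≐Y = #-≐ λ y → X≐Y (N + y)

  #-Δ : ∀ X Y → # (X Δ Y) ≡ # X xor # Y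
  #-Δ X Y = oddCard-Δ-∩ X Y D N

  #↑-Δ : ∀ X Y → #↑ (X Δ Y) ≡ #↑ X xor #↑ Y
  #↑-Δ X Y = #-Δ (shift N X) (shift N Y)

  #-⟨⟩ : ∀ {k} → k ≤ N → # ⟨ k ⟩[ N ] ≡ oddCard D k
  #-⟨⟩ k≤N = trans (oddCard-cong N λ x _ _ → cong (_∧ D x) (⟨⟩-lower k≤N x)) (oddCard-prefix D k≤N)

  #-co : ∀ X → # co[ N ] X ≡ oddCard D N xor # X
  #-co X = trans
    (oddCard-cong N λ x 1≤x x≤N → trans (cong (λ b → (b ∧ not (X x)) ∧ D x) (∈-⋯ 1≤x x≤N)) (not-∧ (X x) (D x)))
    (oddCard-Δ D (X ∩ D) N)

  #-θ : ∀ X → # θ[ N ] X ≡ false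
  #-θ X = oddCard-vanishing N λ x _ x≤N → cong (λ b → (b ∧ X (x ∸ N)) ∧ D x) (>⇒≤ᵇ≡false (s≤s x≤N))

  #↑-θ : ∀ X → #↑ θ[ N ] X ≡ # X
  #↑-θ X = oddCard-cong N λ y 1≤y _ →
    cong (_∧ D y) (cong₂ _∧_ (≤⇒≤ᵇ≡true (m<m+n N 1≤y)) (cong X (m+n∸m≡n N y)))

  #↑-vanishing : ∀ {X} → (∀ x → N < x → X x ≡ false) → #↑ X ≡ false
  #↑-vanishing X≗∅ = oddCard-vanishing N λ y 1≤y _ → cong (_∧ D y) (X≗∅ (N + y) (m<m+n N 1≤y))

  #↑-co : ∀ X → #↑ co[ N ] X ≡ false
  #↑-co X = #↑-vanishing {co[ N ] X} λ x N<x → cong (_∧ not (X x)) (∉-⋯ʳ N<x)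

  #↑-⟨⟩ : ∀ {c} → c ≤ N → #↑ ⟨ c ⟩[ N ] ≡ false
  #↑-⟨⟩ c≤N = #↑-vanishing λ x N<x → trans (⟨⟩-lower c≤N x) (∉-⋯ʳ (≤-<-trans c≤N N<x))

  #-leftSide : ∀ {u} a → u ≤ N → # leftSide N u a ≡ oddCard D N xor oddCard D u
  #-leftSide {u} a u≤N = begin
    # leftSide N u a                                         ≡⟨ #-Δ _ _ ⟩
    # co[ N ] ⟨ u ⟩[ N ] xor # θ[ N ] ⟨ a ⟩[ N ]             ≡⟨ cong₂ _xor_ (#-co ⟨ u ⟩[ N ]) (#-θ ⟨ a ⟩[ N ]) ⟩
    (oddCard D N xor # ⟨ u ⟩[ N ]) xor false                 ≡⟨ xor-identityʳ _ ⟩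
    oddCard D N xor # ⟨ u ⟩[ N ]                             ≡⟨ cong (oddCard D N xor_) (#-⟨⟩ u≤N) ⟩
    oddCard D N xor oddCard D u                              ∎

  #-rightSide : ∀ A B {c k} s′ → c ≤ N → k ≤ N →
    # rightSide N A B c k s′ ≡ (# A xor oddCard D c) xor (oddCard D N xor oddCard D k)
  #-rightSide A B {c} {k} s′ c≤N k≤N = begin
    # rightSide N A B c k s′
      ≡⟨ #-Δ _ _ ⟩
    # (A Δ ⟨ c ⟩[ N ] Δ co[ N ] ⟨ k ⟩[ N ]) xor # θ[ N ] (⟨ s′ ⟩[ N ] Δ ⟨ c ⟩[ N ] Δ B)
      ≡⟨ cong₂ _xor_ (#-Δ _ _) (#-θ (⟨ s′ ⟩[ N ] Δ ⟨ c ⟩[ N ] Δ B)) ⟩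
    (# (A Δ ⟨ c ⟩[ N ]) xor # co[ N ] ⟨ k ⟩[ N ]) xor false
      ≡⟨ xor-identityʳ _ ⟩
    # (A Δ ⟨ c ⟩[ N ]) xor # co[ N ] ⟨ k ⟩[ N ]
      ≡⟨ cong₂ _xor_ (trans (#-Δ _ _) (cong (# A xor_) (#-⟨⟩ c≤N)))
                     (trans (#-co ⟨ k ⟩[ N ]) (cong (oddCard D N xor_) (#-⟨⟩ k≤N))) ⟩
    (# A xor oddCard D c) xor (oddCard D N xor oddCard D k) ∎

  #↑-leftSide : ∀ u {a} → a ≤ N → #↑ leftSide N u a ≡ oddCard D a
  #↑-leftSide u {a} a≤N =
    trans (#↑-Δ (co[ N ] ⟨ u ⟩[ N ]) (θ[ N ] ⟨ a ⟩[ N ]))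
          (cong₂ _xor_ (#↑-co ⟨ u ⟩[ N ]) (trans (#↑-θ ⟨ a ⟩[ N ]) (#-⟨⟩ a≤N)))

  #↑-rightSide : ∀ {A} B {c} k s′ → (∀ x → N < x → A x ≡ false) → c ≤ N →
    #↑ rightSide N A B c k s′ ≡ (# ⟨ s′ ⟩[ N ] xor oddCard D c) xor # B
  #↑-rightSide {A} B {c} k s′ A≗∅ c≤N = begin
    #↑ rightSide N A B c k s′
      ≡⟨ #↑-Δ (A Δ ⟨ c ⟩[ N ] Δ co[ N ] ⟨ k ⟩[ N ]) (θ[ N ] (⟨ s′ ⟩[ N ] Δ ⟨ c ⟩[ N ] Δ B)) ⟩
    #↑ (A Δ ⟨ c ⟩[ N ] Δ co[ N ] ⟨ k ⟩[ N ]) xor #↑ θ[ N ] (⟨ s′ ⟩[ N ] Δ ⟨ c ⟩[ N ] Δ B)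
      ≡⟨ cong₂ _xor_ (trans (#↑-Δ (A Δ ⟨ c ⟩[ N ]) (co[ N ] ⟨ k ⟩[ N ]))
                            (cong₂ _xor_ (trans (#↑-Δ A ⟨ c ⟩[ N ]) (cong₂ _xor_ (#↑-vanishing A≗∅) (#↑-⟨⟩ c≤N)))
                                         (#↑-co ⟨ k ⟩[ N ])))
                     (#↑-θ (⟨ s′ ⟩[ N ] Δ ⟨ c ⟩[ N ] Δ B)) ⟩
    # (⟨ s′ ⟩[ N ] Δ ⟨ c ⟩[ N ] Δ B)
      ≡⟨ trans (#-Δ _ _) (cong (_xor # B) (trans (#-Δ _ _) (cong (# ⟨ s′ ⟩[ N ] xor_) (#-⟨⟩ c≤N)))) ⟩
    (# ⟨ s′ ⟩[ N ] xor oddCard D c) xor # B ∎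

  low-equation : ∀ A B u a c k s′ → # A ≡ false → u ≤ N → c ≤ N → k ≤ N →
    leftSide N u a ≐ rightSide N A B c k s′ → oddCard D u ≡ oddCard D c xor oddCard D k
  low-equation A B u a c k s′ A-even u≤N c≤N k≤N eq = xor-cancelˡ (oddCard D N) (begin
    oddCard D N xor oddCard D u                               ≡⟨ #-leftSide a u≤N ⟨
    # leftSide N u a                                          ≡⟨ #-≐ eq ⟩
    # rightSide N A B c k s′                                  ≡⟨ #-rightSide A B s′ c≤N k≤N ⟩
    (# A xor oddCard D c) xor (oddCard D N xor oddCard D k)   ≡⟨ cong (λ b → (b xor oddCard D c) xor _) A-even ⟩
    oddCard D c xor (oddCard D N xor oddCard D k)
      ≡⟨ solve 3 (λ p n q → p :+ (n :+ q) := n :+ (p :+ q)) refl (oddCard D c) (oddCard D N) (oddCard D k) ⟩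
    oddCard D N xor (oddCard D c xor oddCard D k)             ∎)

  high-equation : ∀ A B u a c k s′ → (∀ x → N < x → A x ≡ false) → # B ≡ false → a ≤ N → c ≤ N →
    leftSide N u a ≐ rightSide N A B c k s′ → oddCard D a ≡ # ⟨ s′ ⟩[ N ] xor oddCard D c
  high-equation A B u a c k s′ A≗∅ B-even a≤N c≤N eq = begin
    oddCard D a                                ≡⟨ #↑-leftSide u a≤N ⟨
    #↑ leftSide N u a                          ≡⟨ #↑-≐ eq ⟩
    #↑ rightSide N A B c k s′                  ≡⟨ #↑-rightSide B k s′ A≗∅ c≤N ⟩
    (# ⟨ s′ ⟩[ N ] xor oddCard D c) xor # B    ≡⟨ cong ((# ⟨ s′ ⟩[ N ] xor oddCard D c) xor_) B-even ⟩
    (# ⟨ s′ ⟩[ N ] xor oddCard D c) xor false  ≡⟨ xor-identityʳ _ ⟩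
    # ⟨ s′ ⟩[ N ] xor oddCard D c              ∎

Balanced : ℕ → NSet → Set
Balanced n X = ∀ t → oddCard (X ∩ multiples t) n ≡ false

generator-bounds : ∀ {m i j} → 2 ≤ i → i ≤ m ∸ 1 → j ≤ 2 ^ (i ∸ 1) ∸ 1 →
  j < 2 ^ (i ∸ 1) × 2 ^ (i ∸ 1) + j < 2 ^ (m ∸ 1)
generator-bounds {m} {suc i} {j} _ i<m j≤2^i-1 = j<2^i , <-≤-trans (2^+<2^suc i j<2^i) (^-monoʳ-≤ 2 i<m)
  where
  j<2^i : j < 2 ^ i
  j<2^i = subst (j <_) (suc-pred (2 ^ i) {{m^n≢0 2 i}}) (s≤s j≤2^i-1)

oddCard-pair-multiples : ∀ t {e j n} → 1 ≤ j → j < 2 ^ e → 2 ^ e + j ≤ n →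
  oddCard (pair j (2 ^ e + j) ∩ multiples t) n ≡ false
oddCard-pair-multiples t {e} {j} {n} 1≤j j<2^e 2^e+j≤n = begin
  oddCard (pair j (2 ^ e + j) ∩ multiples t) n
    ≡⟨ oddCard-Δ-∩ [ j ⋯ j ] [ 2 ^ e + j ⋯ 2 ^ e + j ] (multiples t) n ⟩
  oddCard ([ j ⋯ j ] ∩ multiples t) n xor oddCard ([ 2 ^ e + j ⋯ 2 ^ e + j ] ∩ multiples t) n
    ≡⟨ cong₂ _xor_ (oddCard-singleton (multiples t) 1≤j (≤-trans (m≤n+m j (2 ^ e)) 2^e+j≤n))
                   (oddCard-singleton (multiples t) (≤-trans 1≤j (m≤n+m j (2 ^ e))) 2^e+j≤n) ⟩
  multiples t j xor multiples t (2 ^ e + j)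
    ≡⟨ cong (multiples t j xor_) (multiples-2^+ t {e} 1≤j j<2^e) ⟩
  multiples t j xor multiples t j
    ≡⟨ xor-same (multiples t j) ⟩
  false ∎

InH-vanishing : ∀ {m X} → InH m X → ∀ x → 2 ^ (m ∸ 1) < x → X x ≡ false
InH-vanishing H-∅ _ _ = refl
InH-vanishing {m} (H-gen (gen i j 2≤i i≤m-1 _ j≤2^i-1) X∈H) x N<x
  with generator-bounds {m} 2≤i i≤m-1 j≤2^i-1
... | j<2^i , 2^i+j<N =
  cong₂ _xor_ (cong₂ _xor_ (∉-⋯ʳ {j} (≤-<-trans (m≤n+m j _) b<x)) (∉-⋯ʳ {2 ^ (i ∸ 1) + j} b<x))
              (InH-vanishing X∈H x N<x)
  where
  b<x : 2 ^ (i ∸ 1) + j < x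
  b<x = <-trans 2^i+j<N N<x

InH-balanced : ∀ {m X} → InH m X → Balanced (2 ^ (m ∸ 1)) X
InH-balanced {m} H-∅ t = oddCard-vanishing (2 ^ (m ∸ 1)) λ _ _ _ → refl
InH-balanced {m} (H-gen {g} {X} (gen i j 2≤i i≤m-1 1≤j j≤2^i-1) X∈H) t
  with generator-bounds {m} 2≤i i≤m-1 j≤2^i-1
... | j<2^i , 2^i+j<N =
  trans (oddCard-Δ-∩ g X (multiples t) (2 ^ (m ∸ 1)))
        (cong₂ _xor_ (oddCard-pair-multiples t {i ∸ 1} 1≤j j<2^i (<⇒≤ 2^i+j<N)) (InH-balanced X∈H t))

no-solution-above : ∀ M (A B : NSet) → Balanced (2 ^ M) B → (∀ x → 2 ^ M < x → A x ≡ false) →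
  ∀ u a c k s′ → a < 2 ^ M → c < 2 ^ M → 2 ^ M ≤ s′ → s′ ≤ 2 ^ M + c →
  ¬ (leftSide (2 ^ M) u a ≐ rightSide (2 ^ M) A B c k s′)
no-solution-above M A B B-even A≗∅ u a c k s′ a<N c<N N≤s′ s′≤N+c eq = contradiction (begin
  false                              ≡⟨ oddQuot-small M a<N ⟨
  oddQuot M a                        ≡⟨ high-equation A B u a c k s′ A≗∅ (B-even M) (<⇒≤ a<N) (<⇒≤ c<N) eq ⟩
  # ⟨ s′ ⟩[ 2 ^ M ] xor oddQuot M c  ≡⟨ cong₂ _xor_ s′-at-top (oddQuot-small M c<N) ⟩
  true                               ∎) λ ()
  where
  open Count (2 ^ M) (multiples M)
  s′-at-top : # ⟨ s′ ⟩[ 2 ^ M ] ≡ true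
  s′-at-top = trans (oddCard-∩-multiples-pow ⟨ s′ ⟩[ 2 ^ M ] M)
                    (⟨⟩-∋-top N≤s′ (≤-<-trans s′≤N+c (+-monoʳ-< (2 ^ M) c<N)))

no-solution-below : ∀ M (A B : NSet) → Balanced (2 ^ M) A → Balanced (2 ^ M) B → (∀ x → 2 ^ M < x → A x ≡ false) →
  ∀ u a c k y → u + a ≡ 2 ^ M → k + y ≡ 2 ^ M → 0 < c → 2 ∣ c → c < 2 ^ M → c + y ≤ 2 ^ M →
  ¬ (leftSide (2 ^ M) u a ≐ rightSide (2 ^ M) A B c k (c + y))
no-solution-below M A B A-even B-even A≗∅ u a c k y u+a≡N k+y≡N 0<c 2∣c c<N c+y≤N eq =
  parity-obstruction M u a c k y u+a≡N k+y≡N 0<c 2∣c c<N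
    (λ t → Count.low-equation N (multiples t) A B u a c k (c + y) (A-even t) u≤N (<⇒≤ c<N) k≤N eq)
    (λ t → trans (Count.high-equation N (multiples t) A B u a c k (c + y) A≗∅ (B-even t) a≤N (<⇒≤ c<N) eq)
                 (cong (_xor oddQuot t c) (Count.#-⟨⟩ N (multiples t) c+y≤N)))
  where
  N : ℕ
  N = 2 ^ M
  u≤N : u ≤ N
  u≤N = subst (u ≤_) u+a≡N (m≤m+n u a)
  a≤N : a ≤ N
  a≤N = subst (a ≤_) u+a≡N (m≤n+m a u)
  k≤N : k ≤ N
  k≤N = subst (k ≤_) k+y≡N (m≤m+n k y)

no-solution : ∀ M (A B : NSet) → Balanced (2 ^ M) A → Balanced (2 ^ M) B → (∀ x → 2 ^ M < x → A x ≡ false) →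
  ∀ u a c k s′ → u + a ≡ 2 ^ M → k + s′ ≡ 2 ^ M + c → a < 2 ^ M → 0 < c → 2 ∣ c → c < 2 ^ M → c ≤ s′ →
  ¬ (leftSide (2 ^ M) u a ≐ rightSide (2 ^ M) A B c k s′)
no-solution M A B A-even B-even A≗∅ u a c k s′ u+a≡N k+s′≡N+c a<N 0<c 2∣c c<N c≤s′
  with <-≤-connex s′ (2 ^ M) | m≤n⇒∃[o]m+o≡n c≤s′
... | inj₂ N≤s′ | _ =
  no-solution-above M A B B-even A≗∅ u a c k s′ a<N c<N N≤s′ (subst (s′ ≤_) k+s′≡N+c (m≤n+m s′ k))
... | inj₁ s′<N | y , refl =
  no-solution-below M A B A-even B-even A≗∅ u a c k y u+a≡N k+y≡N 0<c 2∣c c<N (<⇒≤ s′<N)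
  where
  k+y≡N : k + y ≡ 2 ^ M
  k+y≡N = +-cancelʳ-≡ c (k + y) (2 ^ M) (begin
    k + y + c    ≡⟨ +-assoc k y c ⟩
    k + (y + c)  ≡⟨ cong (k +_) (+-comm y c) ⟩
    k + (c + y)  ≡⟨ k+s′≡N+c ⟩
    2 ^ M + c    ∎)

lemma5p1 : ∀ (m : ℕ) → 2 ≤ m →
    ∀ (A B : NSet) → InH m A → InH m B →
    ∀ (j r s : ℕ) → 2 ≤ j → 4 * j ≤ 2 ^ m →
    1 ≤ r → r ≤ 2 ^ (m ∸ 1) →
    2 * j ∸ 1 ≤ s → s ≤ 2 ^ (m ∸ 1) + 2 * j ∸ 2 →
    ¬ ((co[ 2 ^ (m ∸ 1) ] ⟨ 2 ^ (m ∸ 1) ∸ r + 1 ⟩[ 2 ^ (m ∸ 1) ]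
          Δ θ[ 2 ^ (m ∸ 1) ] ⟨ r ∸ 1 ⟩[ 2 ^ (m ∸ 1) ])
       ≐ (A Δ ⟨ 2 * j ∸ 2 ⟩[ 2 ^ (m ∸ 1) ]
          Δ co[ 2 ^ (m ∸ 1) ] ⟨ 2 ^ (m ∸ 1) + 2 * j ∸ 1 ∸ s ⟩[ 2 ^ (m ∸ 1) ]
          Δ θ[ 2 ^ (m ∸ 1) ] (⟨ s ∸ 1 ⟩[ 2 ^ (m ∸ 1) ] Δ ⟨ 2 * j ∸ 2 ⟩[ 2 ^ (m ∸ 1) ] Δ B)))
lemma5p1 m (s≤s (s≤s _)) A B A∈H B∈H j r s j≥2@(s≤s (s≤s _)) 4j≤2^m (s≤s _) r≤N (s≤s c≤s′) s≤N+2j-2 =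
  no-solution (m ∸ 1) A B (InH-balanced A∈H) (InH-balanced B∈H) (InH-vanishing A∈H)
    (N ∸ r + 1) (r ∸ 1) c (N + 2 * j ∸ 1 ∸ s) (s ∸ 1)
    (trans (+-assoc (N ∸ r) 1 (r ∸ 1)) (m∸n+n≡m r≤N)) k+s′≡N+c r≤N 0<c 2∣c c<N c≤s′
  where
  N c : ℕ
  N = 2 ^ (m ∸ 1)
  c = 2 * j ∸ 2

  N+2j≡2+N+c : N + 2 * j ≡ suc (suc (N + c))
  N+2j≡2+N+c = trans (+-suc N (suc c)) (cong suc (+-suc N c))

  k+s′≡N+c : N + 2 * j ∸ 1 ∸ s + (s ∸ 1) ≡ N + c
  k+s′≡N+c = trans (cong (λ n → n ∸ 1 ∸ s + (s ∸ 1)) N+2j≡2+N+c)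
                   (m∸n+n≡m (<⇒≤ (subst (λ n → s ≤ n ∸ 2) N+2j≡2+N+c s≤N+2j-2)))

  0<c : 0 < c
  0<c = ≤-trans (s≤s z≤n) (∸-monoˡ-≤ 2 (*-monoʳ-≤ 2 j≥2))

  2∣c : 2 ∣ c
  2∣c = ∣m+n∣m⇒∣n (m∣m*n j) ∣-refl

  c<N : c < N
  c<N = ≤-trans (n≤1+n (suc c)) (*-cancelˡ-≤ 2 (subst (_≤ 2 ^ m) (*-assoc 2 2 j) 4j≤2^m))
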